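{- For $n\ge1$ and $0<k,j<n$, \[B(n,k,j)=(k+1)B(n-1,k,j)+(n-k)B(n-1,k-1,j)+kB(n-1,k,j-1)+(n-k+1)B(n-1,k-1,j-1),\] and for all $n\ge 0$, $0\le k,j\le n$ the boundary conditions hold: $B(n,0,j)=[j=0]$, $B(n,n,j)=[j=n]$, $B(n,k,0)=A(n,k)$, $B(n,k,n)=A(n,n-k)$. Moreover, the displayed recurrence remains true for all $n\ge1$ and $0\le j,k\le n$ under the convention that $B(n-1,k',j')=0$ whenever $j'\in\{ -1,n\}$ or $k'\in\{ -1,n\}$.
   Context: $\mathcal{B}_n$ is the set of signed permutations of order $n$: bijections $\sigma$ of $\{ -n,\ldots,n\}$ with $\sigma(-i)=-\sigma(i)$, identified with $(0,\sigma_1,\ldots,\sigma_n)$. $\mathrm{des}(\sigma)$ is the number of $i\in\{1,\ldots,n\}$ with $\sigma_{i-1}>\sigma_i$ ($\sigma_0=0$), $\mathrm{neg}(\sigma)$ the number of $i\in\{1,\ldots,n\}$ with $\sigma_i<0$. $B(n,k,j)$ is the number of $\sigma\in\mathcal{B}_n$ with $\mathrm{des}(\sigma)=k$, $\mathrm{neg}(\sigma)=j$. $A(n,k)$ is the Eulerian number: the number of permutations $(\tau_1,\ldots,\tau_n)$ of $\{1,\ldots,n\}$ with exactly $k$ indices $i$ such that $\tau_i>\tau_{i+1}$ (with $A(0,0)=1$). $[p]$ is $1$ if $p$ is true and $0$ otherwise. -}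

module Defs where

open import Data.Nat as ℕ using (ℕ; zero; suc)
open import Data.Integer as ℤ using (ℤ; +_; -[1+_]; ∣_∣)
open import Data.List using (List; []; _∷_; [_]; map; concatMap; _++_; upTo; filter; length)
open import Data.List.Relation.Unary.Unique.Propositional using (Unique)
open import Data.List.Relation.Unary.Unique.DecPropositional ℕ._≟_ using (unique?)
open import Relation.Nullary using (Dec; yes; no)

words : {A : Set} → List A → ℕ → List (List A)
words vals zero    = [ [] ]
words vals (suc m) = concatMap (λ x → map (x ∷_) (words vals m)) vals

descFromℤ : ℤ → List ℤ → ℕ
descFromℤ a []       = 0
descFromℤ a (b ∷ xs) with b ℤ.<? a
... | yes _ = suc (descFromℤ b xs)
... | no  _ = descFromℤ b xs

descFromℕ : ℕ → List ℕ → ℕ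
descFromℕ a []       = 0
descFromℕ a (b ∷ xs) with b ℕ.<? a
... | yes _ = suc (descFromℕ b xs)
... | no  _ = descFromℕ b xs

descentsℕ : List ℕ → ℕ
descentsℕ []       = 0
descentsℕ (a ∷ xs) = descFromℕ a xs

-- Signed permutations of order n, as words (σ₁,…,σₙ) over {±1,…,±n}
-- whose absolute values are pairwise distinct (hence a permutation of
-- {1,…,n}); σ(-i) = -σ(i) determines the rest.

signedLetters : ℕ → List ℤ
signedLetters n = map (λ i → -[1+ i ]) (upTo n) ++ map (λ i → + suc i) (upTo n)

IsSignedPerm : List ℤ → Set
IsSignedPerm w = Unique (map ∣_∣ w)

signedPerms : ℕ → List (List ℤ)
signedPerms n = filter (λ w → unique? (map ∣_∣ w)) (words (signedLetters n) n)

des : List ℤ → ℕ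
des σ = descFromℤ (+ 0) σ

neg : List ℤ → ℕ
neg []      = 0
neg (x ∷ σ) with x ℤ.<? + 0
... | yes _ = suc (neg σ)
... | no  _ = neg σ

B : ℕ → ℕ → ℕ → ℕ
B n k j = length (filter (λ σ → des σ ℕ.≟ k) (filter (λ σ → neg σ ℕ.≟ j) (signedPerms n)))

perms : ℕ → List (List ℕ)
perms n = filter unique? (words (map suc (upTo n)) n)

A : ℕ → ℕ → ℕ
A n k = length (filter (λ τ → descentsℕ τ ℕ.≟ k) (perms n))

⟦_⟧ : {P : Set} → Dec P → ℕ
⟦ yes _ ⟧ = 1
⟦ no  _ ⟧ = 0

-- B with the paper's convention: Bc m k' j' = 0 whenever
-- j' ∈ {-1, m+1} or k' ∈ {-1, m+1} (here m = n-1, so m+1 = n);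
-- otherwise it is B m k' j'.
Bc : ℕ → ℤ → ℤ → ℕ
Bc m -[1+ _ ] j'        = 0
Bc m (+ k)    -[1+ _ ]  = 0
Bc m (+ k)    (+ j) with k ℕ.≟ suc m | j ℕ.≟ suc m
... | yes _ | _     = 0
... | no _  | yes _ = 0
... | no _  | no _  = B m k j

-- Every signed permutation of order m + 1 arises exactly once by inserting
-- m + 1 or -(m + 1) into some slot of a signed permutation σ of order m.
-- The inserted letter is larger (resp. smaller) than 0 and all letters of σ,
-- so it raises neg by 0 (resp. 1), and it raises des by 0 in exactly
-- des σ + 1 (resp. des σ) of the m + 1 slots and by 1 in the others.
-- Summing over σ gives the recurrence. The boundary values follow from it,
-- except for j = 0 and j = n, where σ ↦ (|σ₁|, …, |σₙ|) identifies the
-- signed permutations with ordinary ones, preserving descents when all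
-- signs are positive and exchanging descents and ascents when all are negative.
module Submission where

open import Defs
open import Data.Nat as ℕ using (ℕ; zero; suc; _+_; _*_; _∸_; _≤_; _<_; _≟_; z≤n; s≤s; _≡ᵇ_)
import Data.Nat.Properties as ℕP
open import Data.Nat.ListAction using (sum)
open import Data.Nat.ListAction.Properties using (sum-++)
open import Data.Nat.Tactic.RingSolver using (solve-∀)
open import Data.Integer as ℤ using (ℤ; +_; -[1+_]; ∣_∣; -_; _-_; 1ℤ)
import Data.Integer.Properties as ℤP
open import Data.Bool using (if_then_else_)
open import Data.Maybe using (Maybe; just)
open import Data.Maybe.Properties using (just-injective)
open import Data.Product using (_×_; _,_; proj₁; proj₂)
open import Data.Sum using (_⊎_; inj₁; inj₂)
open import Data.Empty using (⊥-elim)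
open import Function using (_∘_; id)
open import Function.Bundles using (mk⇔)
open import Relation.Nullary using (Dec; yes; no; ¬_)
open import Relation.Nullary.Decidable using (¬?)
open import Relation.Unary using (Pred; Decidable)
open import Level using (0ℓ)
open import Relation.Binary.PropositionalEquality
open import Relation.Binary.Definitions using (tri<; tri≈; tri>)
open import Data.List using (List; []; _∷_; map; concatMap; _++_; upTo; filter; length; head)
import Data.List.Properties as ListP
open import Data.List.Membership.Propositional using (_∈_; lose; find)
open import Data.List.Membership.Propositional.Properties
open import Data.List.Membership.Propositional.Properties.WithK using (unique∧set⇒bag)
open import Data.List.Membership.DecPropositional ℕ._≟_ using (_∈?_)
open import Data.List.Relation.Unary.Any using (here; there)
open import Data.List.Relation.Unary.All as All using (All; []; _∷_)
import Data.List.Relation.Unary.All.Properties as AllP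
open import Data.List.Relation.Unary.AllPairs using ([]; _∷_)
open import Data.List.Relation.Unary.Unique.Propositional using (Unique)
import Data.List.Relation.Unary.Unique.Propositional.Properties as UniqueP
open import Data.List.Relation.Unary.Unique.DecPropositional ℕ._≟_ using (unique?)
open import Data.List.Relation.Binary.Subset.Propositional using (_⊆_)
open import Data.List.Relation.Binary.Subset.Propositional.Properties using (filter⁺′)
open import Data.List.Relation.Binary.BagAndSetEquality using (∼bag⇒↭)
open import Data.List.Relation.Binary.Permutation.Propositional.Properties using (↭-length)

open import Algebra.Properties.CommutativeSemigroup ℕP.+-commutativeSemigroup using (x∙yz≈y∙xz)

open ≡-Reasoning

δ : ℕ → ℕ → ℕ
δ a b = if a ≡ᵇ b then 1 else 0

δ-refl : ∀ a → δ a a ≡ 1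
δ-refl zero    = refl
δ-refl (suc a) = δ-refl a

≡⇒δ≡1 : ∀ {a b} → a ≡ b → δ a b ≡ 1
≡⇒δ≡1 {a} refl = δ-refl a

≢⇒δ≡0 : ∀ {a b} → a ≢ b → δ a b ≡ 0
≢⇒δ≡0 {zero}  {zero}  a≢b = ⊥-elim (a≢b refl)
≢⇒δ≡0 {zero}  {suc b} _   = refl
≢⇒δ≡0 {suc a} {zero}  _   = refl
≢⇒δ≡0 {suc a} {suc b} a≢b = ≢⇒δ≡0 (a≢b ∘ cong suc)

⟦≟⟧≡δ : ∀ a b → ⟦ a ≟ b ⟧ ≡ δ a b
⟦≟⟧≡δ a b with a ≟ b
... | yes a≡b = sym (≡⇒δ≡1 a≡b)
... | no  a≢b = sym (≢⇒δ≡0 a≢b)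

δ-*-subst : ∀ a b (f : ℕ → ℕ) → δ a b * f a ≡ δ a b * f b
δ-*-subst a b f with a ≟ b
... | yes refl = refl
... | no  a≢b  rewrite ≢⇒δ≡0 a≢b = refl

δ-∸-swap : ∀ n a b → a ≤ n → b ≤ n → δ (n ∸ a) b ≡ δ a (n ∸ b)
δ-∸-swap n a b a≤n b≤n with a ≟ n ∸ b
... | yes refl = trans (≡⇒δ≡1 (ℕP.m∸[m∸n]≡n b≤n)) (sym (δ-refl (n ∸ b)))
... | no  a≢n∸b =
  trans (≢⇒δ≡0 {n ∸ a} {b} λ n∸a≡b → a≢n∸b (trans (sym (ℕP.m∸[m∸n]≡n a≤n)) (cong (n ∸_) n∸a≡b)))
        (sym (≢⇒δ≡0 a≢n∸b))

⟦⟧-yes : ∀ {P : Set} (P? : Dec P) → P → ⟦ P? ⟧ ≡ 1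
⟦⟧-yes (yes _) _ = refl
⟦⟧-yes (no ¬p) p = ⊥-elim (¬p p)

⟦⟧-no : ∀ {P : Set} (P? : Dec P) → ¬ P → ⟦ P? ⟧ ≡ 0
⟦⟧-no (yes p) ¬p = ⊥-elim (¬p p)
⟦⟧-no (no _)  _  = refl

⟦⟧-cong : ∀ {P Q : Set} (P? : Dec P) (Q? : Dec Q) → (P → Q) → (Q → P) → ⟦ P? ⟧ ≡ ⟦ Q? ⟧
⟦⟧-cong P? (yes q) _   Q→P = ⟦⟧-yes P? (Q→P q)
⟦⟧-cong P? (no ¬q) P→Q _   = ⟦⟧-no P? (¬q ∘ P→Q)

⟦⟧≡0⊎⟦⟧≡1 : ∀ {P : Set} (P? : Dec P) → ⟦ P? ⟧ ≡ 0 ⊎ ⟦ P? ⟧ ≡ 1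
⟦⟧≡0⊎⟦⟧≡1 (yes _) = inj₂ refl
⟦⟧≡0⊎⟦⟧≡1 (no _)  = inj₁ refl

module _ {X : Set} where

  sum-map-++ : ∀ (h : X → ℕ) xs ys → sum (map h (xs ++ ys)) ≡ sum (map h xs) + sum (map h ys)
  sum-map-++ h xs ys = trans (cong sum (ListP.map-++ h xs ys)) (sum-++ (map h xs) (map h ys))

  sum-map-cong : ∀ {h h′ : X → ℕ} {xs} → All (λ x → h x ≡ h′ x) xs → sum (map h xs) ≡ sum (map h′ xs)
  sum-map-cong = cong sum ∘ ListP.map-cong-local

  sum-map-zero : ∀ {h : X → ℕ} {xs} → All (λ x → h x ≡ 0) xs → sum (map h xs) ≡ 0
  sum-map-zero []           = refl
  sum-map-zero (hx≡0 ∷ h≡0) rewrite hx≡0 = sum-map-zero h≡0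

  sum-map-*ˡ : ∀ c (h : X → ℕ) xs → sum (map (λ x → c * h x) xs) ≡ c * sum (map h xs)
  sum-map-*ˡ c h []       = sym (ℕP.*-zeroʳ c)
  sum-map-*ˡ c h (x ∷ xs) = trans (cong (_+_ (c * h x)) (sum-map-*ˡ c h xs)) (sym (ℕP.*-distribˡ-+ c (h x) _))

  sum-map-linear₄ : ∀ a b c d (h₁ h₂ h₃ h₄ : X → ℕ) xs →
    sum (map (λ x → a * h₁ x + b * h₂ x + c * h₃ x + d * h₄ x) xs) ≡
      a * sum (map h₁ xs) + b * sum (map h₂ xs) + c * sum (map h₃ xs) + d * sum (map h₄ xs)
  sum-map-linear₄ a b c d h₁ h₂ h₃ h₄ [] = zeros a b c d
    where
    zeros : ∀ a b c d → 0 ≡ a * 0 + b * 0 + c * 0 + d * 0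
    zeros = solve-∀
  sum-map-linear₄ a b c d h₁ h₂ h₃ h₄ (x ∷ xs) rewrite sum-map-linear₄ a b c d h₁ h₂ h₃ h₄ xs =
    distrib a b c d (h₁ x) (h₂ x) (h₃ x) (h₄ x)
      (sum (map h₁ xs)) (sum (map h₂ xs)) (sum (map h₃ xs)) (sum (map h₄ xs))
    where
    distrib : ∀ a b c d p q r s P Q R S →
      a * p + b * q + c * r + d * s + (a * P + b * Q + c * R + d * S)
        ≡ a * (p + P) + b * (q + Q) + c * (r + R) + d * (s + S)
    distrib = solve-∀

  length-filter≡sum-δ : ∀ (f : X → ℕ) k xs →
    length (filter (λ x → f x ≟ k) xs) ≡ sum (map (λ x → δ (f x) k) xs)
  length-filter≡sum-δ f k [] = refl
  length-filter≡sum-δ f k (x ∷ xs) with f x ≟ k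
  ... | yes fx≡k rewrite ListP.filter-accept (λ x → f x ≟ k) {x} {xs} fx≡k | ≡⇒δ≡1 fx≡k =
    cong suc (length-filter≡sum-δ f k xs)
  ... | no  fx≢k rewrite ListP.filter-reject (λ x → f x ≟ k) {x} {xs} fx≢k | ≢⇒δ≡0 fx≢k =
    length-filter≡sum-δ f k xs

  sum-map-filter≡sum-δ* : ∀ (h g : X → ℕ) j xs →
    sum (map h (filter (λ x → g x ≟ j) xs)) ≡ sum (map (λ x → δ (g x) j * h x) xs)
  sum-map-filter≡sum-δ* h g j [] = refl
  sum-map-filter≡sum-δ* h g j (x ∷ xs) with g x ≟ j
  ... | yes gx≡j rewrite ListP.filter-accept (λ x → g x ≟ j) {x} {xs} gx≡j | ≡⇒δ≡1 gx≡j =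
    cong₂ _+_ (sym (ℕP.*-identityˡ (h x))) (sum-map-filter≡sum-δ* h g j xs)
  ... | no  gx≢j rewrite ListP.filter-reject (λ x → g x ≟ j) {x} {xs} gx≢j | ≢⇒δ≡0 gx≢j =
    sum-map-filter≡sum-δ* h g j xs

  length-filter²≡sum-δ*δ : ∀ (f g : X → ℕ) k j xs →
    length (filter (λ x → f x ≟ k) (filter (λ x → g x ≟ j) xs))
      ≡ sum (map (λ x → δ (g x) j * δ (f x) k) xs)
  length-filter²≡sum-δ*δ f g k j xs =
    trans (length-filter≡sum-δ f k (filter (λ x → g x ≟ j) xs)) (sum-map-filter≡sum-δ* (λ x → δ (f x) k) g j xs)

  unique-sameMembers⇒length≡ : ∀ {xs ys : List X} → Unique xs → Unique ys → xs ⊆ ys → ys ⊆ xs →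
    length xs ≡ length ys
  unique-sameMembers⇒length≡ ux uy xs⊆ys ys⊆xs =
    ↭-length (∼bag⇒↭ (unique∧set⇒bag ux uy (mk⇔ xs⊆ys ys⊆xs)))

sum-map-concatMap : ∀ {X Y : Set} (h : Y → ℕ) (f : X → List Y) xs →
  sum (map h (concatMap f xs)) ≡ sum (map (λ x → sum (map h (f x))) xs)
sum-map-concatMap h f []       = refl
sum-map-concatMap h f (x ∷ xs) =
  trans (sum-map-++ h (f x) (concatMap f xs)) (cong (_+_ (sum (map h (f x)))) (sum-map-concatMap h f xs))

concatMap-unique : ∀ {X Y : Set} (f : X → List Y) (origin : Y → Maybe X) {xs} → Unique xs →
  (∀ {x} → x ∈ xs → Unique (f x)) → (∀ {x y} → x ∈ xs → y ∈ f x → origin y ≡ just x) →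
  Unique (concatMap f xs)
concatMap-unique f origin {[]}     _                 _       _        = []
concatMap-unique f origin {x ∷ xs} u@(_ ∷ unique-xs) unique-f origin-f =
  UniqueP.++⁺ (unique-f (here refl)) (concatMap-unique f origin unique-xs (unique-f ∘ there) (origin-f ∘ there)) disjoint
  where
  disjoint : ∀ {y} → ¬ (y ∈ f x × y ∈ concatMap f xs)
  disjoint (y∈fx , y∈rest) with find (∈-concatMap⁻ f y∈rest)
  ... | x′ , x′∈xs , y∈fx′ =
    UniqueP.Unique[x∷xs]⇒x∉xs u
      (subst (_∈ xs) (just-injective (trans (sym (origin-f (there x′∈xs) y∈fx′)) (origin-f (here refl) y∈fx))) x′∈xs)

∈-words⁻ : ∀ {X : Set} (vals : List X) n {w} → w ∈ words vals n → length w ≡ n × All (_∈ vals) w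
∈-words⁻ vals zero    (here refl) = refl , []
∈-words⁻ vals (suc n) w∈ with find (∈-concatMap⁻ (λ x → map (x ∷_) (words vals n)) {vals} w∈)
... | x , x∈vals , w∈x∷words with ∈-map⁻ (x ∷_) w∈x∷words
... | w′ , w′∈words , refl with ∈-words⁻ vals n w′∈words
... | |w′|≡n , w′⊆vals = cong suc |w′|≡n , x∈vals ∷ w′⊆vals

∈-words⁺ : ∀ {X : Set} (vals : List X) {w} → All (_∈ vals) w → w ∈ words vals (length w)
∈-words⁺ vals []                   = here refl
∈-words⁺ vals {x ∷ w} (x∈vals ∷ w⊆vals) =
  ∈-concatMap⁺ (λ y → map (y ∷_) (words vals (length w))) (lose x∈vals (∈-map⁺ (x ∷_) (∈-words⁺ vals w⊆vals)))

words-unique : ∀ {X : Set} {vals : List X} → Unique vals → ∀ n → Unique (words vals n)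
words-unique u zero            = [] ∷ []
words-unique {vals = vals} u (suc n) =
  concatMap-unique (λ x → map (x ∷_) (words vals n)) head u
    (λ _ → UniqueP.map⁺ ListP.∷-injectiveʳ (words-unique u n)) head-∈
  where
  head-∈ : ∀ {x w} → x ∈ vals → w ∈ map (x ∷_) (words vals n) → head w ≡ just x
  head-∈ _ w∈ with ∈-map⁻ _ w∈
  ... | _ , _ , refl = refl

InRange : ℕ → ℕ → Set
InRange n i = 0 < i × i ≤ n

InRange-suc⁻ : ∀ {n i} → InRange (suc n) i → i ≢ suc n → InRange n i
InRange-suc⁻ (0<i , i≤1+n) i≢1+n = 0<i , ℕP.≤-pred (ℕP.≤∧≢⇒< i≤1+n i≢1+n)

∈-signedLetters⁻ : ∀ n {x} → x ∈ signedLetters n → InRange n ∣ x ∣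
∈-signedLetters⁻ n x∈ with ∈-++⁻ (map (λ i → -[1+ i ]) (upTo n)) x∈
... | inj₁ x∈neg with ∈-map⁻ _ x∈neg
...   | i , i∈ , refl = s≤s z≤n , ∈-upTo⁻ i∈
∈-signedLetters⁻ n x∈ | inj₂ x∈pos with ∈-map⁻ _ x∈pos
...   | i , i∈ , refl = s≤s z≤n , ∈-upTo⁻ i∈

∈-signedLetters⁺ : ∀ n x → InRange n ∣ x ∣ → x ∈ signedLetters n
∈-signedLetters⁺ n (+ zero)  (() , _)
∈-signedLetters⁺ n (+ suc i) (_ , i<n) =
  ∈-++⁺ʳ (map (λ i → -[1+ i ]) (upTo n)) (∈-map⁺ (λ i → + suc i) (∈-upTo⁺ i<n))
∈-signedLetters⁺ n -[1+ i ]  (_ , i<n) = ∈-++⁺ˡ (∈-map⁺ (λ i → -[1+ i ]) (∈-upTo⁺ i<n))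

signedLetters-unique : ∀ n → Unique (signedLetters n)
signedLetters-unique n =
  UniqueP.++⁺ (UniqueP.map⁺ -[1+-injective (UniqueP.upTo⁺ n)) (UniqueP.map⁺ +suc-injective (UniqueP.upTo⁺ n)) disjoint
  where
  -[1+-injective : ∀ {a b} → -[1+ a ] ≡ -[1+ b ] → a ≡ b
  -[1+-injective refl = refl
  +suc-injective : ∀ {a b} → + suc a ≡ + suc b → a ≡ b
  +suc-injective refl = refl
  disjoint : ∀ {x} → ¬ (x ∈ map (λ i → -[1+ i ]) (upTo n) × x ∈ map (λ i → + suc i) (upTo n))
  disjoint (x∈neg , x∈pos) with ∈-map⁻ _ x∈neg | ∈-map⁻ _ x∈pos
  ... | _ , _ , refl | _ , _ , ()

∈-letters⁻ : ∀ n {i} → i ∈ map suc (upTo n) → InRange n i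
∈-letters⁻ n i∈ with ∈-map⁻ _ i∈
... | i , i∈ , refl = s≤s z≤n , ∈-upTo⁻ i∈

∈-letters⁺ : ∀ n i → InRange n i → i ∈ map suc (upTo n)
∈-letters⁺ n zero    (() , _)
∈-letters⁺ n (suc i) (_ , i<n) = ∈-map⁺ suc (∈-upTo⁺ i<n)

IsSignedPermOf : ℕ → List ℤ → Set
IsSignedPermOf n σ = length σ ≡ n × All (λ x → InRange n ∣ x ∣) σ × Unique (map ∣_∣ σ)

IsPermOf : ℕ → List ℕ → Set
IsPermOf n τ = length τ ≡ n × All (InRange n) τ × Unique τ

∈-signedPerms⁻ : ∀ n {σ} → σ ∈ signedPerms n → IsSignedPermOf n σ
∈-signedPerms⁻ n σ∈ with ∈-filter⁻ (λ w → unique? (map ∣_∣ w)) σ∈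
... | σ∈words , u with ∈-words⁻ (signedLetters n) n σ∈words
... | |σ|≡n , σ⊆letters = |σ|≡n , All.map (∈-signedLetters⁻ n) σ⊆letters , u

∈-signedPerms⁺ : ∀ n {σ} → IsSignedPermOf n σ → σ ∈ signedPerms n
∈-signedPerms⁺ n (refl , inRange , u) =
  ∈-filter⁺ (λ w → unique? (map ∣_∣ w)) (∈-words⁺ (signedLetters n) (All.map (∈-signedLetters⁺ n _) inRange)) u

signedPerms-unique : ∀ n → Unique (signedPerms n)
signedPerms-unique n = UniqueP.filter⁺ (λ w → unique? (map ∣_∣ w)) (words-unique (signedLetters-unique n) n)

∈-perms⁻ : ∀ n {τ} → τ ∈ perms n → IsPermOf n τ
∈-perms⁻ n τ∈ with ∈-filter⁻ unique? τ∈
... | τ∈words , u with ∈-words⁻ (map suc (upTo n)) n τ∈words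
... | |τ|≡n , τ⊆letters = |τ|≡n , All.map (∈-letters⁻ n) τ⊆letters , u

∈-perms⁺ : ∀ n {τ} → IsPermOf n τ → τ ∈ perms n
∈-perms⁺ n (refl , inRange , u) =
  ∈-filter⁺ unique? (∈-words⁺ (map suc (upTo n)) (All.map (∈-letters⁺ n _) inRange)) u

perms-unique : ∀ n → Unique (perms n)
perms-unique n = UniqueP.filter⁺ unique? (words-unique (UniqueP.map⁺ ℕP.suc-injective (UniqueP.upTo⁺ n)) n)

map⁺-injectiveOn : ∀ {X Y : Set} (f : X → Y) {xs} →
  (∀ {a b} → a ∈ xs → b ∈ xs → a ≢ b → f a ≢ f b) → Unique xs → Unique (map f xs)
map⁺-injectiveOn f {[]}     _   []             = []
map⁺-injectiveOn f {a ∷ xs} inj (a∉xs ∷ u) =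
  AllP.map⁺ (All.tabulate (λ b∈ → inj (here refl) (there b∈) (All.lookup a∉xs b∈)))
    ∷ map⁺-injectiveOn f (λ a∈ b∈ → inj (there a∈) (there b∈)) u

unique-inRange⇒length≤ : ∀ n xs → Unique xs → All (InRange n) xs → length xs ≤ n
unique-inRange⇒length≤ n       []       _ _ = z≤n
unique-inRange⇒length≤ zero    (x ∷ xs) _ ((0<x , x≤0) ∷ _) = ⊥-elim (ℕP.<⇒≱ 0<x x≤0)
unique-inRange⇒length≤ (suc n) (x ∷ xs) (x∉xs ∷ u) (x-in ∷ xs-in) =
  s≤s (subst (_≤ n) (ListP.length-map squeeze xs)
    (unique-inRange⇒length≤ n (map squeeze xs) (map⁺-injectiveOn squeeze squeeze-inj u)
      (AllP.map⁺ (All.tabulate squeeze-in))))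
  where
  -- x does not occur in xs, so it can take the place of n + 1 there.
  squeeze : ℕ → ℕ
  squeeze y with y ≟ suc n
  ... | yes _ = x
  ... | no  _ = y
  squeeze-in : ∀ {y} → y ∈ xs → InRange n (squeeze y)
  squeeze-in {y} y∈ with y ≟ suc n
  ... | yes refl = InRange-suc⁻ x-in (All.lookup x∉xs y∈)
  ... | no  y≢   = InRange-suc⁻ (All.lookup xs-in y∈) y≢
  squeeze-inj : ∀ {a b} → a ∈ xs → b ∈ xs → a ≢ b → squeeze a ≢ squeeze b
  squeeze-inj {a} {b} a∈ b∈ a≢b with a ≟ suc n | b ≟ suc n
  ... | yes refl | yes refl = ⊥-elim (a≢b refl)
  ... | yes _    | no  _    = All.lookup x∉xs b∈
  ... | no  _    | yes _    = All.lookup x∉xs a∈ ∘ sym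
  ... | no  _    | no  _    = a≢b

-- Inserting a letter

module _ {X : Set} where

  insertions : X → List X → List (List X)
  insertions x []       = (x ∷ []) ∷ []
  insertions x (y ∷ ys) = (x ∷ y ∷ ys) ∷ map (y ∷_) (insertions x ys)

  ∈-insertions⁻ : ∀ x σ {w} → w ∈ insertions x σ → ∀ {z} → z ∈ w → z ≡ x ⊎ z ∈ σ
  ∈-insertions⁻ x []       (here refl) (here refl) = inj₁ refl
  ∈-insertions⁻ x (y ∷ ys) (here refl) (here refl) = inj₁ refl
  ∈-insertions⁻ x (y ∷ ys) (here refl) (there z∈) = inj₂ z∈
  ∈-insertions⁻ x (y ∷ ys) (there w∈) z∈ with ∈-map⁻ _ w∈
  ... | w′ , w′∈ , refl with z∈
  ...   | here refl = inj₂ (here refl)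
  ...   | there z∈w′ with ∈-insertions⁻ x ys w′∈ z∈w′
  ...     | inj₁ z≡x  = inj₁ z≡x
  ...     | inj₂ z∈ys = inj₂ (there z∈ys)

  length-insertions : ∀ x σ {w} → w ∈ insertions x σ → length w ≡ suc (length σ)
  length-insertions x []       (here refl) = refl
  length-insertions x (y ∷ ys) (here refl) = refl
  length-insertions x (y ∷ ys) (there w∈) with ∈-map⁻ _ w∈
  ... | w′ , w′∈ , refl = cong suc (length-insertions x ys w′∈)

  ++-∈-insertions : ∀ x as bs → as ++ x ∷ bs ∈ insertions x (as ++ bs)
  ++-∈-insertions x []       []       = here refl
  ++-∈-insertions x []       (b ∷ bs) = here refl
  ++-∈-insertions x (a ∷ as) bs       = there (∈-map⁺ (a ∷_) (++-∈-insertions x as bs))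

  insertions-unique : ∀ x σ → All (x ≢_) σ → Unique (insertions x σ)
  insertions-unique x []       _           = [] ∷ []
  insertions-unique x (y ∷ ys) (x≢y ∷ x∉ys) =
    AllP.map⁺ (All.tabulate (λ _ → x≢y ∘ ListP.∷-injectiveˡ))
      ∷ UniqueP.map⁺ ListP.∷-injectiveʳ (insertions-unique x ys x∉ys)

  insertions-map-unique : ∀ {Y : Set} (f : X → Y) x σ → Unique (map f σ) → All (λ y → f x ≢ f y) σ →
    ∀ {w} → w ∈ insertions x σ → Unique (map f w)
  insertions-map-unique f x []       _              _            (here refl) = [] ∷ []
  insertions-map-unique f x (y ∷ ys) u              fx∉          (here refl) = AllP.map⁺ fx∉ ∷ u
  insertions-map-unique f x (y ∷ ys) (fy∉fys ∷ u) (fx≢fy ∷ fx∉) (there w∈) with ∈-map⁻ _ w∈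
  ... | w′ , w′∈ , refl = AllP.map⁺ (All.tabulate fy∉fw′) ∷ insertions-map-unique f x ys u fx∉ w′∈
    where
    fy∉fw′ : ∀ {z} → z ∈ w′ → f y ≢ f z
    fy∉fw′ z∈ with ∈-insertions⁻ x ys w′∈ z∈
    ... | inj₁ refl = fx≢fy ∘ sym
    ... | inj₂ z∈ys = All.lookup (AllP.map⁻ fy∉fys) z∈ys

  filter-insertions : ∀ {P : Pred X 0ℓ} (P? : Decidable P) {x} σ → ¬ P x → All P σ →
    ∀ {w} → w ∈ insertions x σ → filter P? w ≡ σ
  filter-insertions P? []       ¬Px _             (here refl) = ListP.filter-reject P? ¬Px
  filter-insertions P? (y ∷ ys) ¬Px Pσ            (here refl) = trans (ListP.filter-reject P? ¬Px) (ListP.filter-all P? Pσ)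
  filter-insertions P? (y ∷ ys) ¬Px (Py ∷ Pys)   (there w∈) with ∈-map⁻ _ w∈
  ... | w′ , w′∈ , refl = trans (ListP.filter-accept P? Py) (cong (y ∷_) (filter-insertions P? ys ¬Px Pys w′∈))

neg-∷ : ∀ x w → neg (x ∷ w) ≡ ⟦ x ℤ.<? + 0 ⟧ + neg w
neg-∷ x w with x ℤ.<? + 0
... | yes _ = refl
... | no  _ = refl

descFromℤ-∷ : ∀ a x w → descFromℤ a (x ∷ w) ≡ ⟦ x ℤ.<? a ⟧ + descFromℤ x w
descFromℤ-∷ a x w with x ℤ.<? a
... | yes _ = refl
... | no  _ = refl

descFromℕ-∷ : ∀ a x w → descFromℕ a (x ∷ w) ≡ ⟦ x ℕ.<? a ⟧ + descFromℕ x w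
descFromℕ-∷ a x w with x ℕ.<? a
... | yes _ = refl
... | no  _ = refl

descFromℤ≤length : ∀ a w → descFromℤ a w ≤ length w
descFromℤ≤length a []      = z≤n
descFromℤ≤length a (x ∷ w) with x ℤ.<? a
... | yes _ = s≤s (descFromℤ≤length x w)
... | no  _ = ℕP.m≤n⇒m≤1+n (descFromℤ≤length x w)

descFromℕ≤length : ∀ a w → descFromℕ a w ≤ length w
descFromℕ≤length a []      = z≤n
descFromℕ≤length a (x ∷ w) with x ℕ.<? a
... | yes _ = s≤s (descFromℕ≤length x w)
... | no  _ = ℕP.m≤n⇒m≤1+n (descFromℕ≤length x w)

neg≤length : ∀ w → neg w ≤ length w
neg≤length []      = z≤n
neg≤length (x ∷ w) with x ℤ.<? + 0
... | yes _ = s≤s (neg≤length w)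
... | no  _ = ℕP.m≤n⇒m≤1+n (neg≤length w)

neg-insertions : ∀ x σ {w} → w ∈ insertions x σ → neg w ≡ ⟦ x ℤ.<? + 0 ⟧ + neg σ
neg-insertions x []       (here refl) = neg-∷ x []
neg-insertions x (y ∷ ys) (here refl) = neg-∷ x (y ∷ ys)
neg-insertions x (y ∷ ys) (there w∈) with ∈-map⁻ _ w∈
... | w′ , w′∈ , refl = begin
  neg (y ∷ w′)                ≡⟨ neg-∷ y w′ ⟩
  ⟦ y ℤ.<? + 0 ⟧ + neg w′      ≡⟨ cong (_+_ ⟦ y ℤ.<? + 0 ⟧) (neg-insertions x ys w′∈) ⟩
  ⟦ y ℤ.<? + 0 ⟧ + (⟦ x ℤ.<? + 0 ⟧ + neg ys) ≡⟨ x∙yz≈y∙xz ⟦ y ℤ.<? + 0 ⟧ ⟦ x ℤ.<? + 0 ⟧ (neg ys) ⟩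
  ⟦ x ℤ.<? + 0 ⟧ + (⟦ y ℤ.<? + 0 ⟧ + neg ys) ≡⟨ cong (_+_ ⟦ x ℤ.<? + 0 ⟧) (sym (neg-∷ y ys)) ⟩
  ⟦ x ℤ.<? + 0 ⟧ + neg (y ∷ ys) ∎

-- x is below every letter of a ∷ σ when e = 1 and above every letter when c = 1.
-- It keeps the number of descents in the descFromℤ a σ slots inside a descent
-- and, when it is a maximum, in the last slot; every other slot adds a descent.
descents-insertions : ∀ x a σ e c → e + c ≡ 1 →
  All (λ u → ⟦ x ℤ.<? u ⟧ ≡ e × ⟦ u ℤ.<? x ⟧ ≡ c) (a ∷ σ) → ∀ k →
  sum (map (λ w → δ (descFromℤ a w) k) (insertions x σ)) ≡
    δ (descFromℤ a σ) k * (descFromℤ a σ + c) + δ (suc (descFromℤ a σ)) k * (length σ ∸ descFromℤ a σ + e)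
descents-insertions x a [] e c e+c≡1 ((x<a≡e , _) ∷ []) k = begin
  δ (descFromℤ a (x ∷ [])) k + 0     ≡⟨ cong (λ d → δ d k + 0) (trans (descFromℤ-∷ a x []) (cong (_+ 0) x<a≡e)) ⟩
  δ (e + 0) k + 0                    ≡⟨ last-slot e c e+c≡1 ⟩
  δ 0 k * (0 + c) + δ 1 k * (0 + e)  ∎
  where
  last-slot : ∀ e c → e + c ≡ 1 → δ (e + 0) k + 0 ≡ δ 0 k * (0 + c) + δ 1 k * (0 + e)
  last-slot 0 1 refl = maximum (δ 0 k) (δ 1 k)
    where
    maximum : ∀ p q → p + 0 ≡ p * 1 + q * 0
    maximum = solve-∀
  last-slot 1 0 refl = minimum (δ 0 k) (δ 1 k)
    where
    minimum : ∀ p q → q + 0 ≡ p * 0 + q * 1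
    minimum = solve-∀
descents-insertions x a (y ∷ ys) e c e+c≡1 ((x<a≡e , _) ∷ y-cmp@((_ , y<x≡c) ∷ _)) k = begin
  sum (map (λ w → δ (descFromℤ a w) k) (insertions x (y ∷ ys)))
    ≡⟨ cong₂ _+_ (cong (λ d → δ d k) first-slot)
         (trans (cong sum (sym (ListP.map-∘ (insertions x ys))))
                (sum-map-cong {xs = insertions x ys} (All.tabulate (λ {w} _ → cong (λ d → δ d k) (descFromℤ-∷ a y w))))) ⟩
  δ (suc D) k + sum (map (λ w → δ (⟦ y ℤ.<? a ⟧ + descFromℤ y w) k) (insertions x ys))
    ≡⟨ later-slots (⟦⟧≡0⊎⟦⟧≡1 (y ℤ.<? a)) k ⟩
  δ (⟦ y ℤ.<? a ⟧ + D) k * (⟦ y ℤ.<? a ⟧ + D + c)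
    + δ (suc (⟦ y ℤ.<? a ⟧ + D)) k * (suc (length ys) ∸ (⟦ y ℤ.<? a ⟧ + D) + e)
    ≡⟨ cong (λ d → δ d k * (d + c) + δ (suc d) k * (suc (length ys) ∸ d + e)) (sym (descFromℤ-∷ a y ys)) ⟩
  δ (descFromℤ a (y ∷ ys)) k * (descFromℤ a (y ∷ ys) + c)
    + δ (suc (descFromℤ a (y ∷ ys))) k * (length (y ∷ ys) ∸ descFromℤ a (y ∷ ys) + e) ∎
  where
  D = descFromℤ y ys
  IH = descents-insertions x y ys e c e+c≡1 y-cmp
  first-slot : descFromℤ a (x ∷ y ∷ ys) ≡ suc D
  first-slot = begin
    descFromℤ a (x ∷ y ∷ ys)                 ≡⟨ descFromℤ-∷ a x (y ∷ ys) ⟩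
    ⟦ x ℤ.<? a ⟧ + descFromℤ x (y ∷ ys)      ≡⟨ cong (_+_ ⟦ x ℤ.<? a ⟧) (descFromℤ-∷ x y ys) ⟩
    ⟦ x ℤ.<? a ⟧ + (⟦ y ℤ.<? x ⟧ + D)        ≡⟨ cong₂ (λ p q → p + (q + D)) x<a≡e y<x≡c ⟩
    e + (c + D)                               ≡⟨ sym (ℕP.+-assoc e c D) ⟩
    e + c + D                                 ≡⟨ cong (_+ D) e+c≡1 ⟩
    suc D                                     ∎
  later-slots : ∀ {t} → t ≡ 0 ⊎ t ≡ 1 → ∀ k →
    δ (suc D) k + sum (map (λ w → δ (t + descFromℤ y w) k) (insertions x ys)) ≡
      δ (t + D) k * (t + D + c) + δ (suc (t + D)) k * (suc (length ys) ∸ (t + D) + e)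
  later-slots (inj₁ refl) k = begin
    δ (suc D) k + sum (map (λ w → δ (descFromℤ y w) k) (insertions x ys))
      ≡⟨ cong (_+_ (δ (suc D) k)) (IH k) ⟩
    δ (suc D) k + (δ D k * (D + c) + δ (suc D) k * (length ys ∸ D + e))
      ≡⟨ absorb (δ D k) (δ (suc D) k) (D + c) (length ys ∸ D + e) ⟩
    δ D k * (D + c) + δ (suc D) k * (suc (length ys ∸ D) + e)
      ≡⟨ cong (λ s → δ D k * (D + c) + δ (suc D) k * (s + e)) (sym (ℕP.+-∸-assoc 1 (descFromℤ≤length y ys))) ⟩
    δ D k * (D + c) + δ (suc D) k * (suc (length ys) ∸ D + e) ∎
    where
    absorb : ∀ p q s t → q + (p * s + q * t) ≡ p * s + q * suc t
    absorb = solve-∀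
  later-slots (inj₂ refl) zero    = sum-map-zero {xs = insertions x ys} (All.tabulate (λ _ → refl))
  later-slots (inj₂ refl) (suc k) = begin
    δ D k + sum (map (λ w → δ (descFromℤ y w) k) (insertions x ys))
      ≡⟨ cong (_+_ (δ D k)) (IH k) ⟩
    δ D k + (δ D k * (D + c) + δ (suc D) k * (length ys ∸ D + e))
      ≡⟨ absorb (δ D k) (δ (suc D) k) (D + c) (length ys ∸ D + e) ⟩
    δ D k * suc (D + c) + δ (suc D) k * (length ys ∸ D + e) ∎
    where
    absorb : ∀ p q s t → p + (p * s + q * t) ≡ p * suc s + q * t
    absorb = solve-∀

-- Signed permutations of order m + 1 from those of order m

lettersBelow : ∀ {m σ} → IsSignedPermOf m σ → All (λ y → ∣ y ∣ ≢ suc m) σ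
lettersBelow {m} (_ , inRange , _) = All.map (λ (_ , y≤m) ∣y∣≡ → ℕP.1+n≰n (subst (_≤ m) ∣y∣≡ y≤m)) inRange

insertions-isSignedPerm : ∀ m x {σ} → IsSignedPermOf m σ → ∣ x ∣ ≡ suc m →
  ∀ {w} → w ∈ insertions x σ → IsSignedPermOf (suc m) w
insertions-isSignedPerm m x {σ} σ-perm@(|σ|≡m , inRange , u) ∣x∣≡ {w} w∈ =
  trans (length-insertions x σ w∈) (cong suc |σ|≡m) ,
  All.tabulate inRange-w ,
  insertions-map-unique ∣_∣ x σ u
    (All.map (λ ∣y∣≢ ∣x∣≡∣y∣ → ∣y∣≢ (trans (sym ∣x∣≡∣y∣) ∣x∣≡)) (lettersBelow σ-perm)) w∈
  where
  inRange-w : ∀ {z} → z ∈ w → InRange (suc m) ∣ z ∣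
  inRange-w z∈ with ∈-insertions⁻ x σ w∈ z∈
  ... | inj₁ refl = subst (InRange (suc m)) (sym ∣x∣≡) (s≤s z≤n , ℕP.≤-refl)
  ... | inj₂ z∈σ with All.lookup inRange z∈σ
  ...   | 0<z , z≤m = 0<z , ℕP.m≤n⇒m≤1+n z≤m

unique-map-++-∷⁻ : ∀ {X Y : Set} (f : X → Y) {x} as bs → Unique (map f (as ++ x ∷ bs)) →
  Unique (map f (as ++ bs)) × All (λ y → f x ≢ f y) (as ++ bs)
unique-map-++-∷⁻ f []       bs (fx∉ ∷ u) = u , AllP.map⁻ fx∉
unique-map-++-∷⁻ f (a ∷ as) bs (fa∉ ∷ u) with unique-map-++-∷⁻ f as bs u | AllP.++⁻ as (AllP.map⁻ fa∉)
... | u′ , fx∉ | fa∉as , fa≢fx ∷ fa∉bs = AllP.map⁺ (AllP.++⁺ fa∉as fa∉bs) ∷ u′ , (fa≢fx ∘ sym) ∷ fx∉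

maxLetter-∈ : ∀ m {w} → IsSignedPermOf (suc m) w → suc m ∈ map ∣_∣ w
maxLetter-∈ m {w} (|w|≡ , inRange , u) with suc m ∈? map ∣_∣ w
... | yes m+1∈ = m+1∈
... | no  m+1∉ = ⊥-elim (ℕP.1+n≰n (subst (_≤ m) (trans (ListP.length-map ∣_∣ w) |w|≡)
                   (unique-inRange⇒length≤ m (map ∣_∣ w) u (AllP.map⁺ (All.tabulate inRange-m)))))
  where
  inRange-m : ∀ {z} → z ∈ w → InRange m ∣ z ∣
  inRange-m z∈ =
    InRange-suc⁻ (All.lookup inRange z∈) (λ ∣z∣≡ → m+1∉ (subst (_∈ map ∣_∣ w) ∣z∣≡ (∈-map⁺ ∣_∣ z∈)))

delete-isSignedPerm : ∀ m {x} as bs → ∣ x ∣ ≡ suc m → IsSignedPermOf (suc m) (as ++ x ∷ bs) →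
  IsSignedPermOf m (as ++ bs)
delete-isSignedPerm m {x} as bs ∣x∣≡ (|w|≡ , inRange , u) with AllP.++⁻ as inRange | unique-map-++-∷⁻ ∣_∣ as bs u
... | as-in , _ ∷ bs-in | u′ , ∣x∣∉ =
  ℕP.suc-injective (trans (sym (length-insertions x (as ++ bs) (++-∈-insertions x as bs))) |w|≡) ,
  All.zipWith (λ (y-in , ∣x∣≢∣y∣) → InRange-suc⁻ y-in (λ ∣y∣≡ → ∣x∣≢∣y∣ (trans ∣x∣≡ (sym ∣y∣≡))))
    (AllP.++⁺ as-in bs-in , ∣x∣∉) ,
  u′

extensions : ℕ → List ℤ → List (List ℤ)
extensions m σ = insertions (+ suc m) σ ++ insertions -[1+ m ] σ

extendedPerms : ℕ → List (List ℤ)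
extendedPerms m = concatMap (extensions m) (signedPerms m)

∈-extendedPerms⁻ : ∀ m {w} → w ∈ extendedPerms m → IsSignedPermOf (suc m) w
∈-extendedPerms⁻ m w∈ with find (∈-concatMap⁻ (extensions m) {signedPerms m} w∈)
... | σ , σ∈ , w∈ext with ∈-++⁻ (insertions (+ suc m) σ) w∈ext
...   | inj₁ w∈ins = insertions-isSignedPerm m (+ suc m) (∈-signedPerms⁻ m σ∈) refl w∈ins
...   | inj₂ w∈ins = insertions-isSignedPerm m -[1+ m ] (∈-signedPerms⁻ m σ∈) refl w∈ins

∈-extendedPerms⁺ : ∀ m {w} → IsSignedPermOf (suc m) w → w ∈ extendedPerms m
∈-extendedPerms⁺ m w-perm with ∈-map⁻ ∣_∣ (maxLetter-∈ m w-perm)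
... | x , x∈w , m+1≡∣x∣ with ∈-∃++ x∈w
... | as , bs , refl =
  ∈-concatMap⁺ (extensions m) (lose σ∈ (∈-extensions x (sym m+1≡∣x∣)))
  where
  σ∈ : as ++ bs ∈ signedPerms m
  σ∈ = ∈-signedPerms⁺ m (delete-isSignedPerm m as bs (sym m+1≡∣x∣) w-perm)
  ∈-extensions : ∀ x → ∣ x ∣ ≡ suc m → as ++ x ∷ bs ∈ extensions m (as ++ bs)
  ∈-extensions (+ _)     refl = ∈-++⁺ˡ (++-∈-insertions _ as bs)
  ∈-extensions -[1+ _ ] refl = ∈-++⁺ʳ (insertions (+ suc m) (as ++ bs)) (++-∈-insertions _ as bs)

extensions-unique : ∀ m {σ} → IsSignedPermOf m σ → Unique (extensions m σ)
extensions-unique m {σ} σ-perm =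
  UniqueP.++⁺ (insertions-unique (+ suc m) σ (fresh refl)) (insertions-unique -[1+ m ] σ (fresh refl)) disjoint
  where
  fresh : ∀ {x} → ∣ x ∣ ≡ suc m → All (x ≢_) σ
  fresh ∣x∣≡ = All.map (λ ∣y∣≢ x≡y → ∣y∣≢ (trans (cong ∣_∣ (sym x≡y)) ∣x∣≡)) (lettersBelow σ-perm)
  disjoint : ∀ {w} → ¬ (w ∈ insertions (+ suc m) σ × w ∈ insertions -[1+ m ] σ)
  disjoint (w∈⁺ , w∈⁻) =
    ℕP.1+n≢n (sym (trans (sym (neg-insertions (+ suc m) σ w∈⁺)) (neg-insertions -[1+ m ] σ w∈⁻)))

extendedPerms-unique : ∀ m → Unique (extendedPerms m)
extendedPerms-unique m =
  concatMap-unique (extensions m) (just ∘ filter below?) (signedPerms-unique m)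
    (λ σ∈ → extensions-unique m (∈-signedPerms⁻ m σ∈)) origin
  where
  below? : Decidable (λ y → ∣ y ∣ ≢ suc m)
  below? y = ¬? (∣ y ∣ ≟ suc m)
  delete-inserted : ∀ {x σ w} → ∣ x ∣ ≡ suc m → σ ∈ signedPerms m → w ∈ insertions x σ →
    just (filter below? w) ≡ just σ
  delete-inserted {σ = σ} ∣x∣≡ σ∈ w∈ins =
    cong just (filter-insertions below? σ (λ ∣x∣≢ → ∣x∣≢ ∣x∣≡) (lettersBelow (∈-signedPerms⁻ m σ∈)) w∈ins)
  origin : ∀ {σ w} → σ ∈ signedPerms m → w ∈ extensions m σ → just (filter below? w) ≡ just σ
  origin {σ} σ∈ w∈ with ∈-++⁻ (insertions (+ suc m) σ) w∈
  ... | inj₁ w∈ins = delete-inserted refl σ∈ w∈ins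
  ... | inj₂ w∈ins = delete-inserted refl σ∈ w∈ins

-- The recurrence

count : ℕ → (List ℤ → ℕ) → (List ℤ → ℕ) → ℕ → ℕ → ℕ
count m f g k j = sum (map (λ σ → δ (g σ) j * δ (f σ) k) (signedPerms m))

B≡count : ∀ m k j → B m k j ≡ count m des neg k j
B≡count m k j = length-filter²≡sum-δ*δ des neg k j (signedPerms m)

inRange-letters≤ : ∀ {m σ} → IsSignedPermOf m σ → All (λ u → ∣ u ∣ ≤ m) (+ 0 ∷ σ)
inRange-letters≤ (_ , inRange , _) = z≤n ∷ All.map proj₂ inRange

+suc-above : ∀ {m} u → ∣ u ∣ ≤ m → u ℤ.< + suc m
+suc-above (+ _)     n≤m = ℤ.+<+ (s≤s n≤m)
+suc-above -[1+ _ ] _   = ℤ.-<+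

-[1+]-below : ∀ {m} u → ∣ u ∣ ≤ m → -[1+ m ] ℤ.< u
-[1+]-below (+ _)     _   = ℤ.-<+
-[1+]-below -[1+ _ ] n<m = ℤ.-<- n<m

sum-δδ-insertions : ∀ x σ k j →
  sum (map (λ w → δ (neg w) j * δ (des w) k) (insertions x σ))
    ≡ δ (⟦ x ℤ.<? + 0 ⟧ + neg σ) j * sum (map (λ w → δ (des w) k) (insertions x σ))
sum-δδ-insertions x σ k j =
  trans (sum-map-cong {xs = insertions x σ} (All.tabulate (λ {w} w∈ → cong (λ g → δ g j * δ (des w) k) (neg-insertions x σ w∈))))
        (sum-map-*ˡ (δ (⟦ x ℤ.<? + 0 ⟧ + neg σ) j) (λ w → δ (des w) k) (insertions x σ))

sum-δδ-extensions : ∀ m {σ} k j → IsSignedPermOf m σ →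
  sum (map (λ w → δ (neg w) j * δ (des w) k) (extensions m σ)) ≡
    (k + 1) * (δ (neg σ) j * δ (des σ) k) + (suc m ∸ k) * (δ (neg σ) j * δ (suc (des σ)) k)
    + k * (δ (suc (neg σ)) j * δ (des σ) k) + (suc m ∸ k + 1) * (δ (suc (neg σ)) j * δ (suc (des σ)) k)
sum-δδ-extensions m {σ} k j σ-perm@(|σ|≡m , _ , _) = begin
  sum (map H (extensions m σ))
    ≡⟨ sum-map-++ H (insertions (+ suc m) σ) (insertions -[1+ m ] σ) ⟩
  sum (map H (insertions (+ suc m) σ)) + sum (map H (insertions -[1+ m ] σ))
    ≡⟨ cong₂ _+_ (sum-δδ-insertions (+ suc m) σ k j) (sum-δδ-insertions -[1+ m ] σ k j) ⟩
  δ g j * sum (map D (insertions (+ suc m) σ)) + δ (suc g) j * sum (map D (insertions -[1+ m ] σ))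
    ≡⟨ cong₂ (λ p q → δ g j * p + δ (suc g) j * q)
         (descents-insertions (+ suc m) (+ 0) σ 0 1 refl (All.map maximum (inRange-letters≤ σ-perm)) k)
         (descents-insertions -[1+ m ] (+ 0) σ 1 0 refl (All.map minimum (inRange-letters≤ σ-perm)) k) ⟩
  δ g j * (δ d k * (d + 1) + δ (suc d) k * (length σ ∸ d + 0))
    + δ (suc g) j * (δ d k * (d + 0) + δ (suc d) k * (length σ ∸ d + 1))
    ≡⟨ cong (λ ℓ → δ g j * (δ d k * (d + 1) + δ (suc d) k * (ℓ ∸ d + 0))
                 + δ (suc g) j * (δ d k * (d + 0) + δ (suc d) k * (ℓ ∸ d + 1))) |σ|≡m ⟩
  δ g j * (δ d k * (d + 1) + δ (suc d) k * (suc m ∸ suc d + 0))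
    + δ (suc g) j * (δ d k * (d + 0) + δ (suc d) k * (suc m ∸ suc d + 1))
    ≡⟨ cong₂ (λ p q → δ g j * p + δ (suc g) j * q)
         (cong₂ _+_ (δ-*-subst d k (_+ 1)) (δ-*-subst (suc d) k (λ z → suc m ∸ z + 0)))
         (cong₂ _+_ (δ-*-subst d k (_+ 0)) (δ-*-subst (suc d) k (λ z → suc m ∸ z + 1))) ⟩
  δ g j * (δ d k * (k + 1) + δ (suc d) k * (suc m ∸ k + 0))
    + δ (suc g) j * (δ d k * (k + 0) + δ (suc d) k * (suc m ∸ k + 1))
    ≡⟨ regroup (δ g j) (δ (suc g) j) (δ d k) (δ (suc d) k) k (suc m ∸ k) ⟩
  (k + 1) * (δ g j * δ d k) + (suc m ∸ k) * (δ g j * δ (suc d) k)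
    + k * (δ (suc g) j * δ d k) + (suc m ∸ k + 1) * (δ (suc g) j * δ (suc d) k) ∎
  where
  g = neg σ
  d = des σ
  H = λ w → δ (neg w) j * δ (des w) k
  D = λ w → δ (des w) k
  maximum : ∀ {u} → ∣ u ∣ ≤ m → ⟦ + suc m ℤ.<? u ⟧ ≡ 0 × ⟦ u ℤ.<? + suc m ⟧ ≡ 1
  maximum {u} ∣u∣≤m =
    ⟦⟧-no (+ suc m ℤ.<? u) (ℤP.<-asym (+suc-above u ∣u∣≤m)) , ⟦⟧-yes (u ℤ.<? + suc m) (+suc-above u ∣u∣≤m)
  minimum : ∀ {u} → ∣ u ∣ ≤ m → ⟦ -[1+ m ] ℤ.<? u ⟧ ≡ 1 × ⟦ u ℤ.<? -[1+ m ] ⟧ ≡ 0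
  minimum {u} ∣u∣≤m =
    ⟦⟧-yes (-[1+ m ] ℤ.<? u) (-[1+]-below u ∣u∣≤m) , ⟦⟧-no (u ℤ.<? -[1+ m ]) (ℤP.<-asym (-[1+]-below u ∣u∣≤m))
  regroup : ∀ G G′ E E′ k s →
    G * (E * (k + 1) + E′ * (s + 0)) + G′ * (E * (k + 0) + E′ * (s + 1))
      ≡ (k + 1) * (G * E) + s * (G * E′) + k * (G′ * E) + (s + 1) * (G′ * E′)
  regroup = solve-∀

B-suc≡count : ∀ m k j → B (suc m) k j ≡
  (k + 1) * count m des neg k j + (suc m ∸ k) * count m (suc ∘ des) neg k j
  + k * count m des (suc ∘ neg) k j + (suc m ∸ k + 1) * count m (suc ∘ des) (suc ∘ neg) k j
B-suc≡count m k j = begin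
  B (suc m) k j
    ≡⟨ unique-sameMembers⇒length≡
         (UniqueP.filter⁺ des? (UniqueP.filter⁺ neg? (signedPerms-unique (suc m))))
         (UniqueP.filter⁺ des? (UniqueP.filter⁺ neg? (extendedPerms-unique m)))
         (filter⁺′ des? des? id (filter⁺′ neg? neg? id (λ w∈ → ∈-extendedPerms⁺ m (∈-signedPerms⁻ (suc m) w∈))))
         (filter⁺′ des? des? id (filter⁺′ neg? neg? id (λ w∈ → ∈-signedPerms⁺ (suc m) (∈-extendedPerms⁻ m w∈)))) ⟩
  length (filter des? (filter neg? (extendedPerms m)))
    ≡⟨ length-filter²≡sum-δ*δ des neg k j (extendedPerms m) ⟩
  sum (map H (extendedPerms m))
    ≡⟨ sum-map-concatMap H (extensions m) (signedPerms m) ⟩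
  sum (map (λ σ → sum (map H (extensions m σ))) (signedPerms m))
    ≡⟨ sum-map-cong {xs = signedPerms m} (All.tabulate (λ σ∈ → sum-δδ-extensions m k j (∈-signedPerms⁻ m σ∈))) ⟩
  sum (map (λ σ → (k + 1) * (δ (neg σ) j * δ (des σ) k) + (suc m ∸ k) * (δ (neg σ) j * δ (suc (des σ)) k)
                  + k * (δ (suc (neg σ)) j * δ (des σ) k) + (suc m ∸ k + 1) * (δ (suc (neg σ)) j * δ (suc (des σ)) k))
           (signedPerms m))
    ≡⟨ sum-map-linear₄ (k + 1) (suc m ∸ k) k (suc m ∸ k + 1) _ _ _ _ (signedPerms m) ⟩
  (k + 1) * count m des neg k j + (suc m ∸ k) * count m (suc ∘ des) neg k j
  + k * count m des (suc ∘ neg) k j + (suc m ∸ k + 1) * count m (suc ∘ des) (suc ∘ neg) k j ∎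
  where
  des? = λ σ → des σ ≟ k
  neg? = λ σ → neg σ ≟ j
  H = λ w → δ (neg w) j * δ (des w) k

count-des-beyond : ∀ m g {k} j → m < k → count m des g k j ≡ 0
count-des-beyond m g {k} j m<k = sum-map-zero {xs = signedPerms m} (All.tabulate (λ {σ} σ∈ →
  trans (cong (δ (g σ) j *_) (≢⇒δ≡0 (λ des≡k → ℕP.<⇒≱ m<k (subst (_≤ m) des≡k (des≤ σ∈)))))
        (ℕP.*-zeroʳ (δ (g σ) j))))
  where
  des≤ : ∀ {σ} → σ ∈ signedPerms m → des σ ≤ m
  des≤ {σ} σ∈ = subst (des σ ≤_) (proj₁ (∈-signedPerms⁻ m σ∈)) (descFromℤ≤length (+ 0) σ)

count-neg-beyond : ∀ m f k {j} → m < j → count m f neg k j ≡ 0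
count-neg-beyond m f k {j} m<j = sum-map-zero {xs = signedPerms m} (All.tabulate (λ {σ} σ∈ →
  cong (_* δ (f σ) k) (≢⇒δ≡0 (λ neg≡j → ℕP.<⇒≱ m<j (subst (_≤ m) neg≡j (neg≤ σ∈))))))
  where
  neg≤ : ∀ {σ} → σ ∈ signedPerms m → neg σ ≤ m
  neg≤ {σ} σ∈ = subst (neg σ ≤_) (proj₁ (∈-signedPerms⁻ m σ∈)) (neg≤length σ)

count-suc-des-at-0 : ∀ m f g j → count m (suc ∘ f) g 0 j ≡ 0
count-suc-des-at-0 m f g j = sum-map-zero {xs = signedPerms m} (All.tabulate (λ {σ} _ → ℕP.*-zeroʳ (δ (g σ) j)))

count-suc-neg-at-0 : ∀ m f g k → count m f (suc ∘ g) k 0 ≡ 0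
count-suc-neg-at-0 m f g k = sum-map-zero {xs = signedPerms m} (All.tabulate (λ _ → refl))

Bc≡count : ∀ m k j → Bc m (+ k) (+ j) ≡ count m des neg k j
Bc≡count m k j with k ≟ suc m | j ≟ suc m
... | yes refl | _        = sym (count-des-beyond m neg j ℕP.≤-refl)
... | no _     | yes refl = sym (count-neg-beyond m des k ℕP.≤-refl)
... | no _     | no _     = B≡count m k j

Bc-k-1≡count : ∀ m k j → Bc m (+ k - 1ℤ) (+ j) ≡ count m (suc ∘ des) neg k j
Bc-k-1≡count m zero    j = sym (count-suc-des-at-0 m des neg j)
Bc-k-1≡count m (suc k) j = Bc≡count m k j

Bc-j-1≡count : ∀ m k j → Bc m (+ k) (+ j - 1ℤ) ≡ count m des (suc ∘ neg) k j
Bc-j-1≡count m k zero    = sym (count-suc-neg-at-0 m des neg k)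
Bc-j-1≡count m k (suc j) = Bc≡count m k j

Bc-k-1-j-1≡count : ∀ m k j → Bc m (+ k - 1ℤ) (+ j - 1ℤ) ≡ count m (suc ∘ des) (suc ∘ neg) k j
Bc-k-1-j-1≡count m zero    j       = sym (count-suc-des-at-0 m des (suc ∘ neg) j)
Bc-k-1-j-1≡count m (suc k) zero    = sym (count-suc-neg-at-0 m (suc ∘ des) neg (suc k))
Bc-k-1-j-1≡count m (suc k) (suc j) = Bc≡count m k j

linear₄-cong : ∀ a b c d {x₁ x₂ x₃ x₄ y₁ y₂ y₃ y₄ : ℕ} →
  x₁ ≡ y₁ → x₂ ≡ y₂ → x₃ ≡ y₃ → x₄ ≡ y₄ →
  a * x₁ + b * x₂ + c * x₃ + d * x₄ ≡ a * y₁ + b * y₂ + c * y₃ + d * y₄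
linear₄-cong a b c d refl refl refl refl = refl

B-recurrence : ∀ m k j → B (suc m) (suc k) (suc j) ≡
  (suc k + 1) * B m (suc k) (suc j) + (m ∸ k) * B m k (suc j) + suc k * B m (suc k) j + (m ∸ k + 1) * B m k j
B-recurrence m k j =
  trans (B-suc≡count m (suc k) (suc j))
    (linear₄-cong (suc k + 1) (m ∸ k) (suc k) (m ∸ k + 1) (sym (B≡count m (suc k) (suc j)))
      (sym (B≡count m k (suc j))) (sym (B≡count m (suc k) j)) (sym (B≡count m k j)))

B-recurrence-Bc : ∀ m k j → B (suc m) k j ≡
  (k + 1) * Bc m (+ k) (+ j) + (suc m ∸ k) * Bc m (+ k - 1ℤ) (+ j)
  + k * Bc m (+ k) (+ j - 1ℤ) + (suc m ∸ k + 1) * Bc m (+ k - 1ℤ) (+ j - 1ℤ)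
B-recurrence-Bc m k j =
  trans (B-suc≡count m k j)
    (linear₄-cong (k + 1) (suc m ∸ k) k (suc m ∸ k + 1) (sym (Bc≡count m k j))
      (sym (Bc-k-1≡count m k j)) (sym (Bc-j-1≡count m k j)) (sym (Bc-k-1-j-1≡count m k j)))

-- Boundary values

B-no-descents : ∀ n j → B n 0 j ≡ δ j 0
B-no-descents zero    zero    = refl
B-no-descents zero    (suc j) = refl
B-no-descents (suc m) j = begin
  B (suc m) 0 j
    ≡⟨ B-suc≡count m 0 j ⟩
  1 * count m des neg 0 j + suc m * count m (suc ∘ des) neg 0 j
    + 0 * count m des (suc ∘ neg) 0 j + (suc m + 1) * count m (suc ∘ des) (suc ∘ neg) 0 j
    ≡⟨ linear₄-cong 1 (suc m) 0 (suc m + 1) (sym (B≡count m 0 j))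
         (count-suc-des-at-0 m des neg j) (refl {x = count m des (suc ∘ neg) 0 j}) (count-suc-des-at-0 m des (suc ∘ neg) j) ⟩
  1 * B m 0 j + suc m * 0 + 0 * count m des (suc ∘ neg) 0 j + (suc m + 1) * 0
    ≡⟨ only-first (B m 0 j) (suc m) (count m des (suc ∘ neg) 0 j) ⟩
  B m 0 j
    ≡⟨ B-no-descents m j ⟩
  δ j 0 ∎
  where
  only-first : ∀ x a y → 1 * x + a * 0 + 0 * y + (a + 1) * 0 ≡ x
  only-first = solve-∀

B-all-descents : ∀ n j → B n n j ≡ δ j n
B-all-descents zero    j = B-no-descents zero j
B-all-descents (suc m) j = begin
  B (suc m) (suc m) j
    ≡⟨ B-suc≡count m (suc m) j ⟩
  (suc m + 1) * count m des neg (suc m) j + (m ∸ m) * count m (suc ∘ des) neg (suc m) j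
    + suc m * count m des (suc ∘ neg) (suc m) j + (m ∸ m + 1) * count m (suc ∘ des) (suc ∘ neg) (suc m) j
    ≡⟨ linear₄-cong (suc m + 1) (m ∸ m) (suc m) (m ∸ m + 1)
         (count-des-beyond m neg j ℕP.≤-refl) refl (count-des-beyond m (suc ∘ neg) j ℕP.≤-refl) refl ⟩
  (suc m + 1) * 0 + (m ∸ m) * count m (suc ∘ des) neg (suc m) j
    + suc m * 0 + (m ∸ m + 1) * count m (suc ∘ des) (suc ∘ neg) (suc m) j
    ≡⟨ cong (λ z → (suc m + 1) * 0 + z * count m (suc ∘ des) neg (suc m) j
                   + suc m * 0 + (z + 1) * count m (suc ∘ des) (suc ∘ neg) (suc m) j) (ℕP.n∸n≡0 m) ⟩
  (suc m + 1) * 0 + 0 * count m (suc ∘ des) neg (suc m) j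
    + suc m * 0 + 1 * count m (suc ∘ des) (suc ∘ neg) (suc m) j
    ≡⟨ only-last (suc m) (count m (suc ∘ des) neg (suc m) j) (count m (suc ∘ des) (suc ∘ neg) (suc m) j) ⟩
  count m (suc ∘ des) (suc ∘ neg) (suc m) j
    ≡⟨ all-negative-letters-at j ⟩
  δ j (suc m) ∎
  where
  only-last : ∀ a x y → (a + 1) * 0 + 0 * x + a * 0 + 1 * y ≡ y
  only-last = solve-∀
  all-negative-letters-at : ∀ j → count m (suc ∘ des) (suc ∘ neg) (suc m) j ≡ δ j (suc m)
  all-negative-letters-at zero    = count-suc-neg-at-0 m (suc ∘ des) neg (suc m)
  all-negative-letters-at (suc j) = trans (sym (B≡count m m j)) (B-all-descents m j)

-- Signed permutations with constant sign

B≡sum-over-perms : ∀ n k j (e : ℕ → ℤ) → (∀ i → ∣ e i ∣ ≡ i) →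
  (∀ {τ} → IsPermOf n τ → neg (map e τ) ≡ j) →
  (∀ {σ} → IsSignedPermOf n σ → neg σ ≡ j → σ ≡ map e (map ∣_∣ σ)) →
  B n k j ≡ sum (map (λ τ → δ (des (map e τ)) k) (perms n))
B≡sum-over-perms n k j e ∣e∣ neg-e σ≡e∣σ∣ = begin
  B n k j
    ≡⟨ unique-sameMembers⇒length≡
         (UniqueP.filter⁺ des? (UniqueP.filter⁺ neg? (signedPerms-unique n)))
         (UniqueP.filter⁺ des? (UniqueP.map⁺ (ListP.map-injective e-injective) (perms-unique n)))
         (filter⁺′ des? des? id to) (filter⁺′ des? des? id from) ⟩
  length (filter des? (map (map e) (perms n)))
    ≡⟨ length-filter≡sum-δ des k (map (map e) (perms n)) ⟩
  sum (map (λ σ → δ (des σ) k) (map (map e) (perms n)))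
    ≡⟨ cong sum (sym (ListP.map-∘ (perms n))) ⟩
  sum (map (λ τ → δ (des (map e τ)) k) (perms n)) ∎
  where
  des? = λ σ → des σ ≟ k
  neg? = λ σ → neg σ ≟ j
  e-injective : ∀ {a b} → e a ≡ e b → a ≡ b
  e-injective {a} {b} ea≡eb = trans (sym (∣e∣ a)) (trans (cong ∣_∣ ea≡eb) (∣e∣ b))
  ∣e∣-map : ∀ τ → map ∣_∣ (map e τ) ≡ τ
  ∣e∣-map τ = trans (sym (ListP.map-∘ τ)) (trans (ListP.map-cong ∣e∣ τ) (ListP.map-id τ))
  to : filter neg? (signedPerms n) ⊆ map (map e) (perms n)
  to {σ} σ∈ with ∈-filter⁻ neg? σ∈
  ... | σ∈signedPerms , neg≡j with ∈-signedPerms⁻ n σ∈signedPerms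
  ... | σ-perm@(|σ|≡n , inRange , u) =
    subst (_∈ map (map e) (perms n)) (sym (σ≡e∣σ∣ σ-perm neg≡j))
      (∈-map⁺ (map e) (∈-perms⁺ n (trans (ListP.length-map ∣_∣ σ) |σ|≡n , AllP.map⁺ inRange , u)))
  from : map (map e) (perms n) ⊆ filter neg? (signedPerms n)
  from σ∈ with ∈-map⁻ (map e) σ∈
  ... | τ , τ∈ , refl with ∈-perms⁻ n τ∈
  ... | τ-perm@(|τ|≡n , inRange , u) =
    ∈-filter⁺ neg?
      (∈-signedPerms⁺ n (trans (ListP.length-map e τ) |τ|≡n ,
                         AllP.map⁺ (All.map (λ {i} → subst (InRange n) (sym (∣e∣ i))) inRange) ,
                         subst Unique (sym (∣e∣-map τ)) u))
      (neg-e τ-perm)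

descFromℤ-map-+ : ∀ a τ → descFromℤ (+ a) (map +_ τ) ≡ descFromℕ a τ
descFromℤ-map-+ a []      = refl
descFromℤ-map-+ a (b ∷ τ) = begin
  descFromℤ (+ a) (+ b ∷ map +_ τ)
    ≡⟨ descFromℤ-∷ (+ a) (+ b) (map +_ τ) ⟩
  ⟦ + b ℤ.<? + a ⟧ + descFromℤ (+ b) (map +_ τ)
    ≡⟨ cong₂ _+_ (⟦⟧-cong (+ b ℤ.<? + a) (b ℕ.<? a) ℤP.drop‿+<+ ℤ.+<+) (descFromℤ-map-+ b τ) ⟩
  ⟦ b ℕ.<? a ⟧ + descFromℕ b τ
    ≡⟨ sym (descFromℕ-∷ a b τ) ⟩
  descFromℕ a (b ∷ τ) ∎

des-map-+ : ∀ τ → des (map +_ τ) ≡ descentsℕ τ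
des-map-+ []      = refl
des-map-+ (t ∷ τ) = trans (descFromℤ-∷ (+ 0) (+ t) (map +_ τ)) (descFromℤ-map-+ t τ)

neg-map-+ : ∀ τ → neg (map +_ τ) ≡ 0
neg-map-+ []      = refl
neg-map-+ (t ∷ τ) = neg-map-+ τ

neg≡0⇒+-∣∣ : ∀ σ → neg σ ≡ 0 → σ ≡ map +_ (map ∣_∣ σ)
neg≡0⇒+-∣∣ []            _     = refl
neg≡0⇒+-∣∣ (+ n ∷ σ)     neg≡0 = cong (+ n ∷_) (neg≡0⇒+-∣∣ σ neg≡0)
neg≡0⇒+-∣∣ (-[1+ n ] ∷ σ) ()

B-no-negatives : ∀ n k → B n k 0 ≡ A n k
B-no-negatives n k = begin
  B n k 0
    ≡⟨ B≡sum-over-perms n k 0 +_ (λ _ → refl) (λ {τ} _ → neg-map-+ τ) (λ {σ} _ → neg≡0⇒+-∣∣ σ) ⟩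
  sum (map (λ τ → δ (des (map +_ τ)) k) (perms n))
    ≡⟨ sum-map-cong {xs = perms n} (All.tabulate (λ {τ} _ → cong (λ d → δ d k) (des-map-+ τ))) ⟩
  sum (map (λ τ → δ (descentsℕ τ) k) (perms n))
    ≡⟨ sym (length-filter≡sum-δ descentsℕ k (perms n)) ⟩
  A n k ∎

⟦<?⟧+⟦>?⟧≡1 : ∀ {a b} → a ≢ b → ⟦ a ℕ.<? b ⟧ + ⟦ b ℕ.<? a ⟧ ≡ 1
⟦<?⟧+⟦>?⟧≡1 {a} {b} a≢b with ℕP.<-cmp a b
... | tri< a<b _ b≮a = cong₂ _+_ (⟦⟧-yes (a ℕ.<? b) a<b) (⟦⟧-no (b ℕ.<? a) b≮a)
... | tri≈ _ a≡b _   = ⊥-elim (a≢b a≡b)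
... | tri> a≮b _ b<a = cong₂ _+_ (⟦⟧-no (a ℕ.<? b) a≮b) (⟦⟧-yes (b ℕ.<? a) b<a)

descFromℤ-map-negate : ∀ a τ → Unique (a ∷ τ) → descFromℤ (- + a) (map (-_ ∘ +_) τ) + descFromℕ a τ ≡ length τ
descFromℤ-map-negate a []      _                   = refl
descFromℤ-map-negate a (b ∷ τ) ((a≢b ∷ _) ∷ u) = begin
  descFromℤ (- + a) (- + b ∷ map (-_ ∘ +_) τ) + descFromℕ a (b ∷ τ)
    ≡⟨ cong₂ _+_ (descFromℤ-∷ (- + a) (- + b) (map (-_ ∘ +_) τ)) (descFromℕ-∷ a b τ) ⟩
  (⟦ - + b ℤ.<? - + a ⟧ + X) + (⟦ b ℕ.<? a ⟧ + Y)
    ≡⟨ cong (λ z → (z + X) + (⟦ b ℕ.<? a ⟧ + Y))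
         (⟦⟧-cong (- + b ℤ.<? - + a) (a ℕ.<? b) (ℤP.drop‿+<+ ∘ ℤP.neg-cancel-<) (ℤP.neg-mono-< ∘ ℤ.+<+)) ⟩
  (⟦ a ℕ.<? b ⟧ + X) + (⟦ b ℕ.<? a ⟧ + Y)
    ≡⟨ interchange ⟦ a ℕ.<? b ⟧ ⟦ b ℕ.<? a ⟧ X Y ⟩
  (⟦ a ℕ.<? b ⟧ + ⟦ b ℕ.<? a ⟧) + (X + Y)
    ≡⟨ cong₂ _+_ (⟦<?⟧+⟦>?⟧≡1 a≢b) (descFromℤ-map-negate b τ u) ⟩
  suc (length τ) ∎
  where
  X = descFromℤ (- + b) (map (-_ ∘ +_) τ)
  Y = descFromℕ b τ
  interchange : ∀ p q x y → (p + x) + (q + y) ≡ (p + q) + (x + y)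
  interchange = solve-∀

descentsℕ≤length : ∀ τ → descentsℕ τ ≤ length τ
descentsℕ≤length []      = z≤n
descentsℕ≤length (t ∷ τ) = ℕP.m≤n⇒m≤1+n (descFromℕ≤length t τ)

des-map-negate : ∀ τ → All (0 <_) τ → Unique τ → des (map (-_ ∘ +_) τ) ≡ length τ ∸ descentsℕ τ
des-map-negate []          _             _ = refl
des-map-negate (zero  ∷ τ) (() ∷ _)      _
des-map-negate (suc t ∷ τ) _             u = begin
  des (map (-_ ∘ +_) (suc t ∷ τ))  ≡⟨ descFromℤ-∷ (+ 0) -[1+ t ] (map (-_ ∘ +_) τ) ⟩
  suc X                            ≡⟨ sym (ℕP.m+n∸n≡m (suc X) d) ⟩
  suc (X + d) ∸ d                  ≡⟨ cong (λ z → suc z ∸ d) (descFromℤ-map-negate (suc t) τ u) ⟩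
  suc (length τ) ∸ d               ∎
  where
  X = descFromℤ -[1+ t ] (map (-_ ∘ +_) τ)
  d = descFromℕ (suc t) τ

neg-map-negate : ∀ τ → All (0 <_) τ → neg (map (-_ ∘ +_) τ) ≡ length τ
neg-map-negate []          _              = refl
neg-map-negate (suc t ∷ τ) (_ ∷ positive) = cong suc (neg-map-negate τ positive)

neg≡length⇒negate-∣∣ : ∀ σ → neg σ ≡ length σ → σ ≡ map (-_ ∘ +_) (map ∣_∣ σ)
neg≡length⇒negate-∣∣ []            _       = refl
neg≡length⇒negate-∣∣ (-[1+ n ] ∷ σ) neg≡|σ| =
  cong (-[1+ n ] ∷_) (neg≡length⇒negate-∣∣ σ (ℕP.suc-injective neg≡|σ|))
neg≡length⇒negate-∣∣ (+ n ∷ σ)     neg≡|σ| = ⊥-elim (ℕP.1+n≰n (subst (_≤ length σ) neg≡|σ| (neg≤length σ)))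

B-all-negatives : ∀ n k → k ≤ n → B n k n ≡ A n (n ∸ k)
B-all-negatives n k k≤n = begin
  B n k n
    ≡⟨ B≡sum-over-perms n k n (-_ ∘ +_) (λ i → ℤP.∣-i∣≡∣i∣ (+ i))
         (λ {τ} (|τ|≡n , inRange , _) → trans (neg-map-negate τ (All.map proj₁ inRange)) |τ|≡n)
         (λ {σ} (|σ|≡n , _ , _) neg≡n → neg≡length⇒negate-∣∣ σ (trans neg≡n (sym |σ|≡n))) ⟩
  sum (map (λ τ → δ (des (map (-_ ∘ +_) τ)) k) (perms n))
    ≡⟨ sum-map-cong {xs = perms n} (All.tabulate ascents) ⟩
  sum (map (λ τ → δ (descentsℕ τ) (n ∸ k)) (perms n))
    ≡⟨ sym (length-filter≡sum-δ descentsℕ (n ∸ k) (perms n)) ⟩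
  A n (n ∸ k) ∎
  where
  ascents : ∀ {τ} → τ ∈ perms n → δ (des (map (-_ ∘ +_) τ)) k ≡ δ (descentsℕ τ) (n ∸ k)
  ascents {τ} τ∈ with ∈-perms⁻ n τ∈
  ... | refl , inRange , u = trans (cong (λ d → δ d k) (des-map-negate τ (All.map proj₁ inRange) u))
                                   (δ-∸-swap (length τ) (descentsℕ τ) k (descentsℕ≤length τ) k≤n)

theorem2p1 :
  -- recurrence for n ≥ 1 and 0 < k, j < n
  (∀ (n k j : ℕ) → 1 ≤ n → 0 < k → k < n → 0 < j → j < n →
    B n k j ≡ (k + 1) * B (n ∸ 1) k j + (n ∸ k) * B (n ∸ 1) (k ∸ 1) j
              + k * B (n ∸ 1) k (j ∸ 1) + (n ∸ k + 1) * B (n ∸ 1) (k ∸ 1) (j ∸ 1))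
  ×
  -- boundary conditions for n ≥ 0, 0 ≤ k, j ≤ n
  (∀ (n k j : ℕ) → k ≤ n → j ≤ n →
    (B n 0 j ≡ ⟦ j ≟ 0 ⟧) × (B n n j ≡ ⟦ j ≟ n ⟧) ×
    (B n k 0 ≡ A n k) × (B n k n ≡ A n (n ∸ k)))
  ×
  -- recurrence for n ≥ 1 and 0 ≤ k, j ≤ n with the zero convention
  (∀ (n k j : ℕ) → 1 ≤ n → k ≤ n → j ≤ n →
    B n k j ≡ (k + 1) * Bc (n ∸ 1) (+ k) (+ j) + (n ∸ k) * Bc (n ∸ 1) (+ k - 1ℤ) (+ j)
              + k * Bc (n ∸ 1) (+ k) (+ j - 1ℤ) + (n ∸ k + 1) * Bc (n ∸ 1) (+ k - 1ℤ) (+ j - 1ℤ))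
theorem2p1 =
  (λ { (suc m) (suc k) (suc j) _ _ _ _ _ → B-recurrence m k j
     ; zero _ _ () _ _ _ _
     ; (suc _) zero _ _ () _ _ _
     ; (suc _) (suc _) zero _ _ _ () _ }) ,
  (λ n k j k≤n _ → trans (B-no-descents n j) (sym (⟦≟⟧≡δ j 0)) , trans (B-all-descents n j) (sym (⟦≟⟧≡δ j n)) ,
                   B-no-negatives n k , B-all-negatives n k k≤n) ,
  (λ { (suc m) k j _ _ _ → B-recurrence-Bc m k j
     ; zero _ _ () _ _ })
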